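{- Let $S$ be a reduced skip set with $|S|\ge3$, and suppose $G(S)$ contains an odd cycle which, for every $s\in S$, contains at least one $s$-arc. Then $S$ contains at least two odd numbers.
   Context: A skip set is a finite set of positive integers; it is reduced if the greatest common divisor of its elements is $1$. The skip graph $G(S)$ is the simple graph with vertex set $\mathbb{N}=\{0,1,2,\dots\}$ in which, for each $s\in S$ and each integer $j\ge0$, the vertices $2js$ and $(2j+1)s$ are joined by an edge called an $s$-arc (each edge is an $s$-arc for exactly one $s$, namely its length). A cycle is a graph cycle (length at least 3, distinct vertices); an odd cycle is one of odd length. -}

module Defs where

open import Data.Nat using (ℕ; zero; suc; _+_; _*_; _≤_; _<_)
open import Data.Nat.GCD using (gcd)
open import Data.List using (List; []; _∷_; length; foldr; zip; _++_; [_])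
open import Data.List.Relation.Unary.All using (All)
open import Data.List.Relation.Unary.Any using (Any)
open import Data.List.Relation.Unary.Unique.Propositional using (Unique)
open import Data.List.Membership.Propositional using (_∈_)
open import Data.Product using (Σ; ∃; _×_; _,_)
open import Data.Sum using (_⊎_)
open import Relation.Binary.PropositionalEquality using (_≡_; _≢_)

Odd : ℕ → Set
Odd n = ∃ λ k → n ≡ 1 + 2 * k

record SkipSet : Set where
  constructor skipSet
  field
    elems    : List ℕ
    distinct : Unique elems
    positive : All (λ s → 0 < s) elems
open SkipSet public

card : SkipSet → ℕ
card S = length (elems S)

-- gcd of all elements (gcd of the empty set is 0)
gcdAll : List ℕ → ℕ
gcdAll = foldr gcd 0

Reduced : SkipSet → Set
Reduced S = gcdAll (elems S) ≡ 1

IsArc : ℕ → ℕ → ℕ → Set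
IsArc s u v = ∃ λ j →
  (u ≡ (2 * j) * s × v ≡ (2 * j + 1) * s) ⊎
  (v ≡ (2 * j) * s × u ≡ (2 * j + 1) * s)

Adj : SkipSet → ℕ → ℕ → Set
Adj S u v = ∃ λ s → s ∈ elems S × IsArc s u v

cycEdges : List ℕ → List (Σ ℕ (λ _ → ℕ))
cycEdges []       = []
cycEdges (x ∷ xs) = zip (x ∷ xs) (xs ++ [ x ])

record IsCycle (S : SkipSet) (c : List ℕ) : Set where
  field
    len≥3    : 3 ≤ length c
    distinctV : Unique c
    edges    : All (λ e → Adj S (Data.Product.proj₁ e) (Data.Product.proj₂ e)) (cycEdges c)

ContainsArc : ℕ → List ℕ → Set
ContainsArc s c = Any (λ e → IsArc s (Data.Product.proj₁ e) (Data.Product.proj₂ e)) (cycEdges c)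

-- An odd vertex w of G(S) lies only on arcs of odd length, and only as the upper endpoint
-- (2j+1)s, so its neighbours are the vertices w − s with s ∈ S odd. S is reduced, so it has
-- an odd element; if it had only one, t, then a t-arc of the cycle would have an odd upper
-- endpoint w = (2j+1)t whose only neighbour is w − t, while every vertex of a cycle has two.
module Submission where

open import Defs
open import Data.Nat using (ℕ; zero; suc; _+_; _*_; _≤_; s≤s)
open import Data.Nat.Properties using (even≢odd; *-comm; +-comm; +-cancelʳ-≡; suc-injective)
open import Data.Nat.Divisibility using (_∣_; divides; m∣m*n; ∣m⇒∣m*n; ∣n⇒∣m*n; ∣1⇒≡1)
open import Data.Nat.GCD using (gcd-greatest)
open import Data.Nat.Tactic.RingSolver using (solve-∀)
open import Data.List using (List; []; _∷_; _++_; [_]; _∷ʳ_; zip; length; initLast; InitLast)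
open import Data.List.Properties using (++-identityʳ; ++-assoc)
open import Data.List.Relation.Unary.All as All using (All; []; _∷_)
open import Data.List.Relation.Unary.Any using (here; there)
open import Data.List.Relation.Unary.AllPairs using (_∷_)
open import Data.List.Relation.Unary.Unique.Propositional using (Unique)
open import Data.List.Membership.Propositional using (_∈_; find)
open import Data.List.Membership.Propositional.Properties using (∈-∃++)
open import Data.List.Relation.Binary.Permutation.Propositional
  using (_↭_; ↭-sym; ↭-reflexive; ↭⇒↭ₛ; module PermutationReasoning)
open import Data.List.Relation.Binary.Permutation.Propositional.Properties
  using (++-comm; ∷↭∷ʳ; ↭-length; ∈-resp-↭)
open import Data.List.Relation.Binary.Permutation.Setoid.Properties using (Unique-resp-↭)
open import Data.Product using (∃; ∃₂; _×_; _,_)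
open import Data.Sum using (_⊎_; inj₁; inj₂)
open import Data.Empty using (⊥-elim)
open import Relation.Nullary using (¬_)
open import Relation.Binary.PropositionalEquality
  using (_≡_; _≢_; refl; sym; trans; cong; subst; setoid)

even⊎odd : ∀ n → 2 ∣ n ⊎ Odd n
even⊎odd zero = inj₁ (divides 0 refl)
even⊎odd (suc n) with even⊎odd n
... | inj₁ (divides q n≡q*2) = inj₂ (q , cong suc (trans n≡q*2 (*-comm q 2)))
... | inj₂ (k , n≡1+2k)      = inj₁ (divides (suc k) (cong suc (trans n≡1+2k (cong suc (*-comm 2 k)))))

odd⇒∤2 : ∀ {n} → Odd n → ¬ 2 ∣ n
odd⇒∤2 (k , n≡1+2k) (divides q n≡q*2) = even≢odd q k (trans (*-comm 2 q) (trans (sym n≡q*2) n≡1+2k))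

odd-* : ∀ {m n} → Odd m → Odd n → Odd (m * n)
odd-* (j , refl) (k , refl) = j + k + 2 * j * k , identity j k
  where
  identity : ∀ j k → (1 + 2 * j) * (1 + 2 * k) ≡ 1 + 2 * (j + k + 2 * j * k)
  identity = solve-∀

gcdAll-greatest : ∀ {d} xs → All (d ∣_) xs → d ∣ gcdAll xs
gcdAll-greatest []       []         = divides 0 refl
gcdAll-greatest (_ ∷ xs) (d∣x ∷ d∣xs) = gcd-greatest d∣x (gcdAll-greatest xs d∣xs)

data OddElements (xs : List ℕ) : Set where
  noOdd     : All (2 ∣_) xs → OddElements xs
  uniqueOdd : ∀ {t} → t ∈ xs → Odd t → (∀ {s} → s ∈ xs → Odd s → s ≡ t) → OddElements xs
  twoOdd    : ∀ {a b} → a ∈ xs → b ∈ xs → a ≢ b → Odd a → Odd b → OddElements xs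

oddElements : ∀ xs → Unique xs → OddElements xs
oddElements []       _ = noOdd []
oddElements (x ∷ xs) (x∉xs ∷ uniq) with oddElements xs uniq | even⊎odd x
... | twoOdd a∈ b∈ a≢b odd-a odd-b | _ = twoOdd (there a∈) (there b∈) a≢b odd-a odd-b
... | noOdd evens | inj₁ even-x = noOdd (even-x ∷ evens)
... | noOdd evens | inj₂ odd-x  = uniqueOdd (here refl) odd-x only-x
  where
  only-x : ∀ {s} → s ∈ x ∷ xs → Odd s → s ≡ x
  only-x (here s≡x) _     = s≡x
  only-x (there s∈) odd-s = ⊥-elim (odd⇒∤2 odd-s (All.lookup evens s∈))
... | uniqueOdd {t} t∈ odd-t only-t | inj₁ even-x = uniqueOdd (there t∈) odd-t only-t′
  where
  only-t′ : ∀ {s} → s ∈ x ∷ xs → Odd s → s ≡ t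
  only-t′ (here refl) odd-x = ⊥-elim (odd⇒∤2 odd-x even-x)
  only-t′ (there s∈)  odd-s = only-t s∈ odd-s
... | uniqueOdd t∈ odd-t _ | inj₂ odd-x = twoOdd (here refl) (there t∈) (All.lookup x∉xs t∈) odd-x odd-t

IsArc-sym : ∀ {s u v} → IsArc s u v → IsArc s v u
IsArc-sym (j , inj₁ uv) = j , inj₂ uv
IsArc-sym (j , inj₂ vu) = j , inj₁ vu

Adj-sym : ∀ S {u v} → Adj S u v → Adj S v u
Adj-sym S (s , s∈S , arc) = s , s∈S , IsArc-sym arc

odd-2j+1 : ∀ j → Odd (2 * j + 1)
odd-2j+1 j = j , +-comm (2 * j) 1

arc-odd-endpoint : ∀ {s u v} → Odd s → IsArc s u v → Odd u ⊎ Odd v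
arc-odd-endpoint odd-s (j , inj₁ (_ , refl)) = inj₂ (odd-* (odd-2j+1 j) odd-s)
arc-odd-endpoint odd-s (j , inj₂ (_ , refl)) = inj₁ (odd-* (odd-2j+1 j) odd-s)

arc-from-odd : ∀ {s w x} → IsArc s w x → Odd w → Odd s × x + s ≡ w
arc-from-odd {s} (j , inj₁ (refl , _)) odd-w = ⊥-elim (odd⇒∤2 odd-w (∣m⇒∣m*n s (m∣m*n j)))
arc-from-odd {s} (j , inj₂ (refl , refl)) odd-w with even⊎odd s
... | inj₁ even-s = ⊥-elim (odd⇒∤2 odd-w (∣n⇒∣m*n (2 * j + 1) even-s))
... | inj₂ odd-s  = odd-s , identity j s
  where
  identity : ∀ j s → 2 * j * s + s ≡ (2 * j + 1) * s
  identity = solve-∀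

odd-vertex-neighbour : ∀ S {w x} → Adj S w x → Odd w → ∃ λ s → s ∈ elems S × Odd s × x + s ≡ w
odd-vertex-neighbour S (s , s∈S , arc) odd-w with arc-from-odd arc odd-w
... | odd-s , x+s≡w = s , s∈S , odd-s , x+s≡w

odd-vertex-neighbour-unique : ∀ S {t w x y} → (∀ {s} → s ∈ elems S → Odd s → s ≡ t) →
  Odd w → Adj S w x → Adj S w y → x ≡ y
odd-vertex-neighbour-unique S {t} {w} {x} {y} only-t odd-w adj-x adj-y =
  +-cancelʳ-≡ t x y (trans (neighbour adj-x) (sym (neighbour adj-y)))
  where
  neighbour : ∀ {z} → Adj S w z → z + t ≡ w
  neighbour adj with odd-vertex-neighbour S adj odd-w
  ... | s , s∈S , odd-s , z+s≡w rewrite only-t s∈S odd-s = z+s≡w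

zip-∷ʳ : ∀ {A B : Set} (x : A) (y : B) xs ys → length xs ≡ length ys →
         zip (xs ∷ʳ x) (ys ∷ʳ y) ≡ zip xs ys ∷ʳ (x , y)
zip-∷ʳ x y []       []       _         = refl
zip-∷ʳ x y (a ∷ xs) (b ∷ ys) |xs|≡|ys| = cong ((a , b) ∷_) (zip-∷ʳ x y xs ys (suc-injective |xs|≡|ys|))

cycEdges-rotate₁ : ∀ a xs → cycEdges (a ∷ xs) ↭ cycEdges (xs ∷ʳ a)
cycEdges-rotate₁ a []       = ↭-reflexive refl
cycEdges-rotate₁ a (b ∷ xs)
  rewrite zip-∷ʳ a b (b ∷ xs) (xs ∷ʳ a) (↭-length (∷↭∷ʳ a xs)) = ∷↭∷ʳ (a , b) _

cycEdges-rotate : ∀ xs ys → cycEdges (xs ++ ys) ↭ cycEdges (ys ++ xs)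
cycEdges-rotate []       ys = ↭-reflexive (cong cycEdges (sym (++-identityʳ ys)))
cycEdges-rotate (a ∷ xs) ys = begin
  cycEdges (a ∷ xs ++ ys)        ↭⟨ cycEdges-rotate₁ a (xs ++ ys) ⟩
  cycEdges ((xs ++ ys) ∷ʳ a)     ≡⟨ cong cycEdges (++-assoc xs ys [ a ]) ⟩
  cycEdges (xs ++ ys ∷ʳ a)       ↭⟨ cycEdges-rotate xs (ys ∷ʳ a) ⟩
  cycEdges ((ys ∷ʳ a) ++ xs)     ≡⟨ cong cycEdges (++-assoc ys [ a ] xs) ⟩
  cycEdges (ys ++ a ∷ xs)        ∎
  where open PermutationReasoning

∈-zip⁻ : ∀ {xs ys : List ℕ} {x y} → (x , y) ∈ zip xs ys → x ∈ xs × y ∈ ys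
∈-zip⁻ {_ ∷ _} {_ ∷ _} (here refl) = here refl , here refl
∈-zip⁻ {_ ∷ _} {_ ∷ _} (there xy∈) with ∈-zip⁻ xy∈
... | x∈ , y∈ = there x∈ , there y∈

∈-cycEdges⁻ : ∀ c {u v} → (u , v) ∈ cycEdges c → u ∈ c × v ∈ c
∈-cycEdges⁻ (x ∷ xs) uv∈ with ∈-zip⁻ uv∈
... | u∈ , v∈ = u∈ , ∈-resp-↭ (↭-sym (∷↭∷ʳ x xs)) v∈

TwoNeighbours : ℕ → List ℕ → Set
TwoNeighbours w c = ∃₂ λ p n → p ≢ n × (p , w) ∈ cycEdges c × (w , n) ∈ cycEdges c

unique-resp-↭ : ∀ {xs ys : List ℕ} → xs ↭ ys → Unique xs → Unique ys
unique-resp-↭ xs↭ys = Unique-resp-↭ (setoid ℕ) (↭⇒↭ₛ xs↭ys)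

head-twoNeighbours : ∀ w xs → 3 ≤ length (w ∷ xs) → Unique (w ∷ xs) → TwoNeighbours w (w ∷ xs)
head-twoNeighbours w []       (s≤s ()) _
head-twoNeighbours w (n ∷ ms) _ uniq with initLast ms
head-twoNeighbours w (n ∷ .[]) (s≤s (s≤s ())) _ | []
... | r InitLast.∷ʳ′ p = p , n , p≢n , pw∈ , here refl
  where
  rotated : (w ∷ n ∷ r) ++ [ p ] ↭ p ∷ w ∷ n ∷ r
  rotated = ++-comm (w ∷ n ∷ r) [ p ]
  p≢n : p ≢ n
  p≢n with unique-resp-↭ rotated uniq
  ... | (_ ∷ p≢n ∷ _) ∷ _ = p≢n
  pw∈ : (p , w) ∈ cycEdges (w ∷ n ∷ r ∷ʳ p)
  pw∈ = ∈-resp-↭ (↭-sym (cycEdges-rotate (w ∷ n ∷ r) [ p ])) (here refl)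

twoNeighbours-rotate : ∀ w as bs → TwoNeighbours w ((w ∷ bs) ++ as) → TwoNeighbours w (as ++ w ∷ bs)
twoNeighbours-rotate w as bs (p , n , p≢n , pw∈ , wn∈) = p , n , p≢n , back pw∈ , back wn∈
  where
  back : ∀ {e} → e ∈ cycEdges ((w ∷ bs) ++ as) → e ∈ cycEdges (as ++ w ∷ bs)
  back = ∈-resp-↭ (cycEdges-rotate (w ∷ bs) as)

cycle-twoNeighbours : ∀ c {w} → 3 ≤ length c → Unique c → w ∈ c → TwoNeighbours w c
cycle-twoNeighbours c {w} |c|≥3 uniq w∈c with ∈-∃++ w∈c
... | as , bs , refl = twoNeighbours-rotate w as bs
  (head-twoNeighbours w (bs ++ as) (subst (3 ≤_) (↭-length rotated) |c|≥3) (unique-resp-↭ rotated uniq))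
  where
  rotated : as ++ w ∷ bs ↭ w ∷ bs ++ as
  rotated = ++-comm as (w ∷ bs)

cycle-odd-vertex : ∀ {s} c → Odd s → ContainsArc s c → ∃ λ w → w ∈ c × Odd w
cycle-odd-vertex c odd-s has-arc with find has-arc
... | (u , v) , uv∈ , arc with arc-odd-endpoint odd-s arc | ∈-cycEdges⁻ c uv∈
...   | inj₁ odd-u | u∈ , _ = u , u∈ , odd-u
...   | inj₂ odd-v | _ , v∈ = v , v∈ , odd-v

claim18 : (S : SkipSet) → Reduced S → 3 ≤ card S →
    (c : List ℕ) → IsCycle S c → Odd (length c) →
    All (λ s → ContainsArc s c) (elems S) →
    ∃ λ a → ∃ λ b → a ∈ elems S × b ∈ elems S × a ≢ b × Odd a × Odd b
claim18 S reduced _ c cyc _ arcs with oddElements (elems S) (distinct S)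
... | twoOdd a∈ b∈ a≢b odd-a odd-b = _ , _ , a∈ , b∈ , a≢b , odd-a , odd-b
... | noOdd evens with ∣1⇒≡1 (subst (2 ∣_) reduced (gcdAll-greatest (elems S) evens))
...   | ()
claim18 S _ _ c cyc _ arcs | uniqueOdd t∈S odd-t only-t
  with cycle-odd-vertex c odd-t (All.lookup arcs t∈S)
... | w , w∈c , odd-w with cycle-twoNeighbours c (IsCycle.len≥3 cyc) (IsCycle.distinctV cyc) w∈c
...   | p , n , p≢n , pw∈ , wn∈ =
  ⊥-elim (p≢n (odd-vertex-neighbour-unique S only-t odd-w
                 (Adj-sym S (All.lookup (IsCycle.edges cyc) pw∈)) (All.lookup (IsCycle.edges cyc) wn∈)))
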